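{- Let $H$ and $G$ be Abelian groups that are isotyped (as algebras of the variety $\Theta$ of Abelian groups), and suppose that one of them is a finitely generated free Abelian group. Then $H$ and $G$ are isomorphic.
   Context: Let $X^0=\{x_1,x_2,\dots\}$ be a countable set of variables; for finite $X\subset X^0$, $W(X)$ is the free $\Theta$-algebra on $X$; a homomorphism $\mu:W(X)\to H$ is a point. Formulas of sort $X$, $\Phi(X)$, are defined inductively over all finite $X$: equalities $w\equiv w'$ ($w,w'\in W(X)$) are in $\Phi(X)$; $\Phi(X)$ is closed under $\neg,\vee,\wedge$ and $\exists x$ for $x\in X$; if $u\in\Phi(X)$ and $s:W(X)\to W(Y)$ is a homomorphism then $s_*u\in\Phi(Y)$. Values $Val^X_H(u)\subseteq\mathrm{Hom}(W(X),H)$: $Val^X_H(w\equiv w')=\{\mu:\mu(w)=\mu(w')\}$; $\mu\in Val^X_H(\exists x\,u)$ iff some point $\nu$ agreeing with $\mu$ on $X\setminus\{x\}$ is in $Val^X_H(u)$; $\neg,\vee,\wedge$ are complement, union, intersection; $\mu\in Val^Y_H(s_*v)$ iff $\mu\circ s\in Val^X_H(v)$. $LKer(\mu)=\{u\in\Phi(X):\mu\in Val^X_H(u)\}$. A set $T\subseteq\Phi(X)$ is an $X$-type of $H$ if $T=LKer(\mu)$ for some point $\mu:W(X)\to H$. Algebras $H_1,H_2\in\Theta$ are isotyped if for every finite $X\subset X^0$, every $X$-type of $H_1$ is an $X$-type of $H_2$ and vice versa. -}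

module Defs where

open import Level using (Level; _⊔_; Lift)
open import Data.Nat using (ℕ; zero; suc)
open import Data.Integer using (ℤ; +_; -[1+_])
open import Data.Fin using (Fin)
open import Data.Product using (Σ; _×_; _,_)
open import Data.Sum using (_⊎_)
open import Relation.Nullary using (¬_)
open import Relation.Binary.PropositionalEquality using (_≡_; _≢_)
open import Algebra.Bundles using (AbelianGroup)
open import Algebra.Morphism.Structures using (module GroupMorphisms)

-- The free Θ-algebra W(X), Θ = abelian groups, on a finite set X of
-- n variables (X identified with Fin n).  Elements of W(X) are
-- represented by group terms; two terms denote the same element of W(X)
-- iff they are equal under every assignment in every abelian group.
-- A homomorphism W(X) → H (a point) is determined by (and given by)
-- the images of the free generators, i.e. a map Fin n → Carrier H.

data Term (n : ℕ) : Set where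
  var  : Fin n → Term n
  zer  : Term n
  _⊕_  : Term n → Term n → Term n
  neg  : Term n → Term n

data Φ : ℕ → Set where
  _≐_  : ∀ {n} → Term n → Term n → Φ n
  ¬'_  : ∀ {n} → Φ n → Φ n
  _∨'_ : ∀ {n} → Φ n → Φ n → Φ n
  _∧'_ : ∀ {n} → Φ n → Φ n → Φ n
  ∃'   : ∀ {n} → Fin n → Φ n → Φ n
  -- s_* u  for a homomorphism s : W(X) → W(Y), given on generators
  push : ∀ {m n} → (Fin m → Term n) → Φ m → Φ n

module _ {c ℓ : Level} (H : AbelianGroup c ℓ) where
  open AbelianGroup H

  Point : ℕ → Set c
  Point n = Fin n → Carrier

  eval : ∀ {n} → Point n → Term n → Carrier
  eval μ (var x) = μ x
  eval μ zer = ε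
  eval μ (t ⊕ u) = eval μ t ∙ eval μ u
  eval μ (neg t) = eval μ t ⁻¹

  compose : ∀ {m n} → Point n → (Fin m → Term n) → Point m
  compose μ s x = eval μ (s x)

  Val : ∀ {n} → Φ n → Point n → Set (c ⊔ ℓ)
  Val (w ≐ w') μ = Lift c (eval μ w ≈ eval μ w')
  Val (¬' u) μ = ¬ Val u μ
  Val (u ∨' v) μ = Val u μ ⊎ Val v μ
  Val (u ∧' v) μ = Val u μ × Val v μ
  Val (∃' x u) μ = Σ (Point _) λ ν → (∀ y → y ≢ x → ν y ≈ μ y) × Val u ν
  Val (push s v) μ = Val v (compose μ s)

  _·ℕ_ : ℕ → Carrier → Carrier
  zero ·ℕ h = ε
  suc k ·ℕ h = h ∙ (k ·ℕ h)

  _·_ : ℤ → Carrier → Carrier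
  (+ k) · h = k ·ℕ h
  -[1+ k ] · h = (suc k ·ℕ h) ⁻¹

  lincomb : ∀ {n} → (Fin n → ℤ) → (Fin n → Carrier) → Carrier
  lincomb {zero} c b = ε
  lincomb {suc n} c b = (c Fin.zero · b Fin.zero) ∙ lincomb (λ i → c (Fin.suc i)) (λ i → b (Fin.suc i))
    where import Data.Fin as Fin

  IsFinGenFree : Set (c ⊔ ℓ)
  IsFinGenFree =
    Σ ℕ λ n → Σ (Fin n → Carrier) λ b →
      (∀ h → Σ (Fin n → ℤ) λ k → lincomb k b ≈ h) ×
      (∀ k k' → lincomb k b ≈ lincomb k' b → ∀ i → k i ≡ k' i)

SameLKer : ∀ {c ℓ c' ℓ'} (H : AbelianGroup c ℓ) (G : AbelianGroup c' ℓ') {n : ℕ} →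
           Point H n → Point G n → Set (c ⊔ ℓ ⊔ c' ⊔ ℓ')
SameLKer H G {n} μ ν = ∀ (u : Φ n) → (Val H u μ → Val G u ν) × (Val G u ν → Val H u μ)

Isotyped : ∀ {c ℓ c' ℓ'} → AbelianGroup c ℓ → AbelianGroup c' ℓ' → Set (c ⊔ ℓ ⊔ c' ⊔ ℓ')
Isotyped H G =
  (∀ (n : ℕ) (μ : Point H n) → Σ (Point G n) λ ν → SameLKer H G μ ν) ×
  (∀ (n : ℕ) (ν : Point G n) → Σ (Point H n) λ μ → SameLKer H G μ ν)

Isomorphic : ∀ {c ℓ c' ℓ'} → AbelianGroup c ℓ → AbelianGroup c' ℓ' → Set (c ⊔ ℓ ⊔ c' ⊔ ℓ')
Isomorphic H G =
  Σ (AbelianGroup.Carrier H → AbelianGroup.Carrier G)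
    (GroupMorphisms.IsGroupIsomorphism (AbelianGroup.rawGroup H) (AbelianGroup.rawGroup G))

-- Let H be free abelian with basis b = (b₁,…,bₙ) and G isotyped with H.  Take a point ν of G
-- with the same type as b, and let f : H → G be the homomorphism sending bᵢ to νᵢ.  The
-- equalities Σ kᵢxᵢ ≐ Σ k'ᵢxᵢ transport between b and ν, so f is injective.  For surjectivity
-- take g ∈ G and a point ρ = (ρ₀, μ) of H with the type of (g, ν).  Then μ has the type of b,
-- and the heart of the proof is that such a μ generates H: once ρ₀ = Σ kᵢμᵢ, the formula
-- x₀ ≐ Σ kᵢxᵢ moves back to (g, ν) and gives g = Σ kᵢνᵢ = f(Σ kᵢbᵢ).
--
-- Why μ generates H: writing μ = A b, the formula "x ∈ A·Hⁿ" holds at μ, hence at b, which gives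
-- an endomorphism ψ with ψ(μᵢ) = bᵢ; with φ : bᵢ ↦ μᵢ this means ψ ∘ φ = id.  For every m ≥ 1
-- the sentence "H = ⟨x₁,…,xₙ⟩ + mH" (a finite disjunction over residues mod m) holds at b, hence
-- at μ, which makes every element of ker ψ divisible by every m (up to double negation, since
-- ∀ is read as ¬∃¬).  In a free group of finite rank that forces ker ψ = 0, decidably coordinate
-- by coordinate, and then h = φ(ψ h) for all h.
module Submission where

open import Defs hiding (_·ℕ_; _·_)
import Defs
open import Level using (Level; lift; lower)
open import Function using (_∘_)
open import Data.Nat as ℕ using (ℕ; zero; suc; _<_)
import Data.Nat.Properties as ℕP
open import Data.Nat.Divisibility using (_∣_; m∣m*n; >⇒∤)
open import Data.Integer as ℤ using (ℤ; +_; -[1+_]; _⊖_; ∣_∣)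
import Data.Integer.Properties as ℤP
open import Data.Integer.DivMod using (_/ℕ_; _%ℕ_; a≡a%ℕn+[a/ℕn]*n; n%ℕd<d)
open import Data.Fin using (Fin; zero; suc; _↑ˡ_; _↑ʳ_; splitAt)
open import Data.Sum.Properties using ([,]-map)
open import Data.Vec.Functional using (_∷_; tail; _++_)
open import Data.Vec.Functional.Properties using (lookup-++ˡ; lookup-++ʳ)
open import Data.Product using (Σ; _×_; _,_; proj₁; proj₂)
open import Data.Sum using (_⊎_; inj₁; inj₂)
open import Data.Empty using (⊥-elim)
open import Relation.Nullary using (¬_; yes; no)
open import Relation.Nullary.Negation using (¬¬-map; contradiction)
open import Relation.Binary.PropositionalEquality as ≡ using (_≡_)
open import Algebra.Bundles using (AbelianGroup)
open import Algebra.Morphism.Structures using (module GroupMorphisms)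

module Multiples {c ℓ : Level} (K : AbelianGroup c ℓ) where
  open AbelianGroup K
  open import Algebra.Properties.CommutativeMonoid.Mult commutativeMonoid
    using (×-congʳ; ×-homo-+; ×-distrib-+)
    renaming (_×_ to _×ᵐ_)
  open import Algebra.Properties.AbelianGroup K using (⁻¹-∙-comm)
  open import Algebra.Properties.Group group using (ε⁻¹≈ε)
  open import Algebra.Solver.CommutativeMonoid commutativeMonoid using (solve; _⊜_; _⊕_)
  open import Relation.Binary.Reasoning.Setoid setoid

  infixr 8 _·ℕ_ _·_
  _·ℕ_ : ℕ → Carrier → Carrier
  _·ℕ_ = Defs._·ℕ_ K
  _·_ : ℤ → Carrier → Carrier
  _·_ = Defs._·_ K

  ·ℕ≡× : ∀ a x → a ·ℕ x ≡ a ×ᵐ x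
  ·ℕ≡× zero x = ≡.refl
  ·ℕ≡× (suc a) x = ≡.cong (x ∙_) (·ℕ≡× a x)

  ·ℕ-congʳ : ∀ a {x y} → x ≈ y → a ·ℕ x ≈ a ·ℕ y
  ·ℕ-congʳ a {x} {y} x≈y rewrite ·ℕ≡× a x | ·ℕ≡× a y = ×-congʳ a x≈y

  ·ℕ-+ : ∀ a b x → (a ℕ.+ b) ·ℕ x ≈ a ·ℕ x ∙ b ·ℕ x
  ·ℕ-+ a b x rewrite ·ℕ≡× (a ℕ.+ b) x | ·ℕ≡× a x | ·ℕ≡× b x = ×-homo-+ x a b

  ·ℕ-∙ : ∀ a x y → a ·ℕ (x ∙ y) ≈ a ·ℕ x ∙ a ·ℕ y
  ·ℕ-∙ a x y rewrite ·ℕ≡× a (x ∙ y) | ·ℕ≡× a x | ·ℕ≡× a y = ×-distrib-+ x y a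

  ·ℕ-ε : ∀ a → a ·ℕ ε ≈ ε
  ·ℕ-ε zero = refl
  ·ℕ-ε (suc a) = trans (identityˡ _) (·ℕ-ε a)

  ·ℕ-⁻¹ : ∀ a x → a ·ℕ (x ⁻¹) ≈ (a ·ℕ x) ⁻¹
  ·ℕ-⁻¹ zero x = sym ε⁻¹≈ε
  ·ℕ-⁻¹ (suc a) x = trans (∙-congˡ (·ℕ-⁻¹ a x)) (⁻¹-∙-comm x (a ·ℕ x))

  ·-congʳ : ∀ i {x y} → x ≈ y → i · x ≈ i · y
  ·-congʳ (+ a) x≈y = ·ℕ-congʳ a x≈y
  ·-congʳ -[1+ a ] x≈y = ⁻¹-cong (·ℕ-congʳ (suc a) x≈y)

  ⊖-· : ∀ p q x → (p ⊖ q) · x ≈ p ·ℕ x ∙ (q ·ℕ x) ⁻¹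
  ⊖-· p zero x = sym (trans (∙-congˡ ε⁻¹≈ε) (identityʳ _))
  ⊖-· zero (suc q) x = sym (identityˡ _)
  ⊖-· (suc p) (suc q) x = begin
    (suc p ⊖ suc q) · x                    ≡⟨ ≡.cong (_· x) (ℤP.[1+m]⊖[1+n]≡m⊖n p q) ⟩
    (p ⊖ q) · x                            ≈⟨ ⊖-· p q x ⟩
    p ·ℕ x ∙ (q ·ℕ x) ⁻¹                   ≈⟨ identityˡ _ ⟨
    ε ∙ (p ·ℕ x ∙ (q ·ℕ x) ⁻¹)             ≈⟨ ∙-congʳ (inverseʳ x) ⟨
    (x ∙ x ⁻¹) ∙ (p ·ℕ x ∙ (q ·ℕ x) ⁻¹)    ≈⟨ solve 4 (λ a a' b b' → (a ⊕ a') ⊕ (b ⊕ b') ⊜ (a ⊕ b) ⊕ (a' ⊕ b'))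
                                                 refl x (x ⁻¹) (p ·ℕ x) ((q ·ℕ x) ⁻¹) ⟩
    (x ∙ p ·ℕ x) ∙ (x ⁻¹ ∙ (q ·ℕ x) ⁻¹)    ≈⟨ ∙-congˡ (⁻¹-∙-comm x (q ·ℕ x)) ⟩
    (x ∙ p ·ℕ x) ∙ (x ∙ q ·ℕ x) ⁻¹         ∎

  ·-+ : ∀ i j x → (i ℤ.+ j) · x ≈ i · x ∙ j · x
  ·-+ (+ a) (+ b) x = ·ℕ-+ a b x
  ·-+ (+ a) -[1+ b ] x = ⊖-· a (suc b) x
  ·-+ -[1+ a ] (+ b) x = trans (⊖-· b (suc a) x) (comm _ _)
  ·-+ -[1+ a ] -[1+ b ] x = begin
    (suc (suc (a ℕ.+ b)) ·ℕ x) ⁻¹          ≡⟨ ≡.cong (λ k → (suc k ·ℕ x) ⁻¹) (ℕP.+-suc a b) ⟨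
    ((suc a ℕ.+ suc b) ·ℕ x) ⁻¹            ≈⟨ ⁻¹-cong (·ℕ-+ (suc a) (suc b) x) ⟩
    (suc a ·ℕ x ∙ suc b ·ℕ x) ⁻¹           ≈⟨ ⁻¹-∙-comm _ _ ⟨
    (suc a ·ℕ x) ⁻¹ ∙ (suc b ·ℕ x) ⁻¹      ∎

  ·ℕ-· : ∀ m i x → m ·ℕ (i · x) ≈ (+ m ℤ.* i) · x
  ·ℕ-· zero i x = reflexive (≡.cong (_· x) (≡.sym (ℤP.*-zeroˡ i)))
  ·ℕ-· (suc m) i x = begin
    i · x ∙ m ·ℕ (i · x)     ≈⟨ ∙-congˡ (·ℕ-· m i x) ⟩
    i · x ∙ (+ m ℤ.* i) · x  ≈⟨ ·-+ i (+ m ℤ.* i) x ⟨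
    (i ℤ.+ + m ℤ.* i) · x    ≡⟨ ≡.cong (_· x) (ℤP.suc-* (+ m) i) ⟨
    (+ suc m ℤ.* i) · x      ∎

  ·-divMod : ∀ m .{{_ : ℕ.NonZero m}} i x → i · x ≈ (i %ℕ m) ·ℕ x ∙ m ·ℕ ((i /ℕ m) · x)
  ·-divMod m i x = begin
    i · x                                      ≡⟨ ≡.cong (_· x) (a≡a%ℕn+[a/ℕn]*n i m) ⟩
    (+ (i %ℕ m) ℤ.+ (i /ℕ m) ℤ.* + m) · x      ≈⟨ ·-+ (+ (i %ℕ m)) ((i /ℕ m) ℤ.* + m) x ⟩
    (i %ℕ m) ·ℕ x ∙ ((i /ℕ m) ℤ.* + m) · x     ≡⟨ ≡.cong (λ j → (i %ℕ m) ·ℕ x ∙ j · x) (ℤP.*-comm (i /ℕ m) (+ m)) ⟩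
    (i %ℕ m) ·ℕ x ∙ (+ m ℤ.* (i /ℕ m)) · x     ≈⟨ ∙-congˡ (·ℕ-· m (i /ℕ m) x) ⟨
    (i %ℕ m) ·ℕ x ∙ m ·ℕ ((i /ℕ m) · x)        ∎

  lincomb-cong : ∀ {n} {k k' : Fin n → ℤ} {s t : Fin n → Carrier} →
                 (∀ i → k i ≡ k' i) → (∀ i → s i ≈ t i) → lincomb K k s ≈ lincomb K k' t
  lincomb-cong {zero} k≡k' s≈t = refl
  lincomb-cong {suc n} {k} {k'} {s} {t} k≡k' s≈t =
    ∙-cong (trans (reflexive (≡.cong (_· s zero) (k≡k' zero))) (·-congʳ (k' zero) (s≈t zero)))
           (lincomb-cong (k≡k' ∘ suc) (s≈t ∘ suc))

  lincomb-+ : ∀ {n} (k k' : Fin n → ℤ) (t : Fin n → Carrier) →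
              lincomb K (λ i → k i ℤ.+ k' i) t ≈ lincomb K k t ∙ lincomb K k' t
  lincomb-+ {zero} k k' t = sym (identityˡ _)
  lincomb-+ {suc n} k k' t = begin
    (k zero ℤ.+ k' zero) · t zero ∙ lincomb K (λ i → k (suc i) ℤ.+ k' (suc i)) (tail t)
      ≈⟨ ∙-cong (·-+ (k zero) (k' zero) (t zero)) (lincomb-+ (k ∘ suc) (k' ∘ suc) (tail t)) ⟩
    (k zero · t zero ∙ k' zero · t zero) ∙ (lincomb K (k ∘ suc) (tail t) ∙ lincomb K (k' ∘ suc) (tail t))
      ≈⟨ solve 4 (λ a a' b b' → (a ⊕ a') ⊕ (b ⊕ b') ⊜ (a ⊕ b) ⊕ (a' ⊕ b')) refl _ _ _ _ ⟩
    lincomb K k t ∙ lincomb K k' t ∎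

  lincomb-0 : ∀ {n} (t : Fin n → Carrier) → lincomb K (λ _ → + 0) t ≈ ε
  lincomb-0 {zero} t = refl
  lincomb-0 {suc n} t = trans (identityˡ _) (lincomb-0 (tail t))

  lincomb-·ℕ : ∀ {n} m (k : Fin n → ℤ) (t : Fin n → Carrier) →
               m ·ℕ lincomb K k t ≈ lincomb K (λ i → + m ℤ.* k i) t
  lincomb-·ℕ zero k t = sym (trans (lincomb-cong (ℤP.*-zeroˡ ∘ k) (λ _ → refl)) (lincomb-0 t))
  lincomb-·ℕ (suc m) k t = begin
    lincomb K k t ∙ m ·ℕ lincomb K k t           ≈⟨ ∙-congˡ (lincomb-·ℕ m k t) ⟩
    lincomb K k t ∙ lincomb K (λ i → + m ℤ.* k i) t ≈⟨ lincomb-+ k _ t ⟨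
    lincomb K (λ i → k i ℤ.+ + m ℤ.* k i) t     ≈⟨ lincomb-cong (λ i → ≡.sym (ℤP.suc-* (+ m) (k i))) (λ _ → refl) ⟩
    lincomb K (λ i → + suc m ℤ.* k i) t         ∎

module Homomorphism {c₁ ℓ₁ c₂ ℓ₂ : Level} (K₁ : AbelianGroup c₁ ℓ₁) (K₂ : AbelianGroup c₂ ℓ₂)
  (F : AbelianGroup.Carrier K₁ → AbelianGroup.Carrier K₂)
  (F-cong : ∀ {x y} → AbelianGroup._≈_ K₁ x y → AbelianGroup._≈_ K₂ (F x) (F y))
  (F-∙ : ∀ x y → AbelianGroup._≈_ K₂ (F (AbelianGroup._∙_ K₁ x y)) (AbelianGroup._∙_ K₂ (F x) (F y))) where
  private
    module A = AbelianGroup K₁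
    module MA = Multiples K₁
    module MB = Multiples K₂
  open AbelianGroup K₂
  open import Algebra.Properties.Group group using (∙-cancelˡ; inverseˡ-unique)

  F-ε : F A.ε ≈ ε
  F-ε = ∙-cancelˡ (F A.ε) (F A.ε) ε
    (trans (sym (F-∙ A.ε A.ε)) (trans (F-cong (A.identityˡ A.ε)) (sym (identityʳ (F A.ε)))))

  F-⁻¹ : ∀ x → F (x A.⁻¹) ≈ F x ⁻¹
  F-⁻¹ x = inverseˡ-unique _ _ (trans (sym (F-∙ _ _)) (trans (F-cong (A.inverseˡ x)) F-ε))

  F-·ℕ : ∀ a x → F (a MA.·ℕ x) ≈ a MB.·ℕ F x
  F-·ℕ zero x = F-ε
  F-·ℕ (suc a) x = trans (F-∙ _ _) (∙-congˡ (F-·ℕ a x))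

  F-· : ∀ i x → F (i MA.· x) ≈ i MB.· F x
  F-· (+ a) x = F-·ℕ a x
  F-· -[1+ a ] x = trans (F-⁻¹ _) (⁻¹-cong (F-·ℕ (suc a) x))

  F-lincomb : ∀ {n} (k : Fin n → ℤ) (t : Fin n → A.Carrier) → F (lincomb K₁ k t) ≈ lincomb K₂ k (F ∘ t)
  F-lincomb {zero} k t = F-ε
  F-lincomb {suc n} k t = trans (F-∙ _ _) (∙-cong (F-· (k zero) (t zero)) (F-lincomb (k ∘ suc) (tail t)))

bijective-homomorphism⇒isomorphic :
  ∀ {c ℓ c' ℓ'} (H : AbelianGroup c ℓ) (G : AbelianGroup c' ℓ') (f : AbelianGroup.Carrier H → AbelianGroup.Carrier G) →
  (f-cong : ∀ {x y} → AbelianGroup._≈_ H x y → AbelianGroup._≈_ G (f x) (f y)) →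
  (f-∙ : ∀ x y → AbelianGroup._≈_ G (f (AbelianGroup._∙_ H x y)) (AbelianGroup._∙_ G (f x) (f y))) →
  (∀ {x y} → AbelianGroup._≈_ G (f x) (f y) → AbelianGroup._≈_ H x y) →
  (∀ y → Σ (AbelianGroup.Carrier H) λ x → AbelianGroup._≈_ G (f x) y) →
  Isomorphic H G
bijective-homomorphism⇒isomorphic H G f f-cong f-∙ f-injective f-surjective = f , record
  { isGroupMonomorphism = record
    { isGroupHomomorphism = record
      { isMonoidHomomorphism = record
        { isMagmaHomomorphism = record
          { isRelHomomorphism = record { cong = f-cong }
          ; homo = f-∙ }
        ; ε-homo = F-ε }
      ; ⁻¹-homo = F-⁻¹ }
    ; injective = f-injective }
  ; surjective = λ y → proj₁ (f-surjective y) , λ z≈x → AbelianGroup.trans G (f-cong z≈x) (proj₂ (f-surjective y)) }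
  where open Homomorphism H G f f-cong f-∙

isomorphic-sym : ∀ {c ℓ c' ℓ'} (H : AbelianGroup c ℓ) (G : AbelianGroup c' ℓ') → Isomorphic G H → Isomorphic H G
isomorphic-sym H G (f , f-iso) = bijective-homomorphism⇒isomorphic H G g g-cong g-∙ g-injective g-surjective
  where
  module H = AbelianGroup H
  module G = AbelianGroup G
  open GroupMorphisms.IsGroupIsomorphism f-iso
  g : H.Carrier → G.Carrier
  g y = proj₁ (surjective y)
  f∘g : ∀ y → f (g y) H.≈ y
  f∘g y = proj₂ (surjective y) G.refl
  g-cong : ∀ {x y} → x H.≈ y → g x G.≈ g y
  g-cong x≈y = injective (H.trans (f∘g _) (H.trans x≈y (H.sym (f∘g _))))
  g-∙ : ∀ x y → g (x H.∙ y) G.≈ g x G.∙ g y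
  g-∙ x y = injective (H.trans (f∘g _) (H.trans (H.∙-cong (H.sym (f∘g x)) (H.sym (f∘g y))) (H.sym (∙-homo _ _))))
  g-injective : ∀ {x y} → g x G.≈ g y → x H.≈ y
  g-injective gx≈gy = H.trans (H.sym (f∘g _)) (H.trans (⟦⟧-cong gx≈gy) (f∘g _))
  g-surjective : ∀ x → Σ H.Carrier λ y → g y G.≈ x
  g-surjective x = f x , injective (f∘g _)

mulℕT : ∀ {n} → ℕ → Term n → Term n
mulℕT zero t = zer
mulℕT (suc a) t = t ⊕ mulℕT a t

mulT : ∀ {n} → ℤ → Term n → Term n
mulT (+ a) t = mulℕT a t
mulT -[1+ a ] t = neg (mulℕT (suc a) t)

linTerm : ∀ {k n} → (Fin k → ℤ) → (Fin k → Term n) → Term n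
linTerm {zero} k v = zer
linTerm {suc _} k v = mulT (k zero) (v zero) ⊕ linTerm (k ∘ suc) (tail v)

module TermSemantics {c ℓ : Level} (K : AbelianGroup c ℓ) where
  open AbelianGroup K
  open Multiples K

  eval-mulℕT : ∀ {n} (μ : Point K n) a t → eval K μ (mulℕT a t) ≡ a ·ℕ eval K μ t
  eval-mulℕT μ zero t = ≡.refl
  eval-mulℕT μ (suc a) t = ≡.cong (eval K μ t ∙_) (eval-mulℕT μ a t)

  eval-mulT : ∀ {n} (μ : Point K n) i t → eval K μ (mulT i t) ≡ i · eval K μ t
  eval-mulT μ (+ a) t = eval-mulℕT μ a t
  eval-mulT μ -[1+ a ] t = ≡.cong _⁻¹ (eval-mulℕT μ (suc a) t)

  eval-linTerm : ∀ {k n} (μ : Point K n) (c : Fin k → ℤ) (v : Fin k → Term n) →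
                 eval K μ (linTerm c v) ≡ lincomb K c (eval K μ ∘ v)
  eval-linTerm {zero} μ c v = ≡.refl
  eval-linTerm {suc _} μ c v =
    ≡.cong₂ _∙_ (eval-mulT μ (c zero) (v zero)) (eval-linTerm μ (c ∘ suc) (tail v))

⊤ᶠ : ∀ {n} → Φ n
⊤ᶠ = zer ≐ zer

⋀ : ∀ {k n} → (Fin k → Φ n) → Φ n
⋀ {zero} f = ⊤ᶠ
⋀ {suc _} f = f zero ∧' ⋀ (f ∘ suc)

⋁< : ∀ {n} → ℕ → (ℕ → Φ n) → Φ n
⋁< zero f = ¬' ⊤ᶠ
⋁< (suc m) f = f m ∨' ⋁< m f

-- the substitution x₀ ↦ 0, xᵢ₊₁ ↦ xᵢ, which makes x₀ a fresh variable
dropHead : ∀ {n} → Fin (suc n) → Term n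
dropHead zero = zer
dropHead (suc i) = var i

∃₀ : ∀ {n} → Φ (suc n) → Φ n
∃₀ u = push dropHead (∃' zero u)

∀₀ : ∀ {n} → Φ (suc n) → Φ n
∀₀ u = ¬' ∃₀ (¬' u)

∃ⁿ : ∀ k {n} → Φ (k ℕ.+ n) → Φ n
∃ⁿ zero u = u
∃ⁿ (suc k) u = ∃ⁿ k (∃₀ u)

-- "x = A y for some y", i.e. xᵢ = Σⱼ Aᵢⱼ yⱼ; the yⱼ are the first k variables of ∃ⁿ
inImage : ∀ {k n} → (Fin n → Fin k → ℤ) → Φ n
inImage {k} {n} A = ∃ⁿ k (⋀ λ i → var (k ↑ʳ i) ≐ linTerm (A i) (λ j → var (j ↑ˡ n)))

subtractMultiple : ∀ {n} → ℕ → Fin (suc n) → Term (suc (suc n))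
subtractMultiple a zero = var zero ⊕ neg (mulℕT a (var (suc zero)))
subtractMultiple a (suc i) = var (suc (suc i))

-- "x₀ ∈ ⟨x₁,…,xₙ⟩ + m·H": some x₀ − Σ aᵢxᵢ with all 0 ≤ aᵢ < m is a multiple of m.  Choosing
-- the coefficients one at a time keeps the disjunction finite.
spanMod : ℕ → ∀ n → Φ (suc n)
spanMod m zero = ∃₀ (var (suc zero) ≐ mulℕT m (var zero))
spanMod m (suc n) = ⋁< m λ a → push (subtractMultiple a) (spanMod m n)

module FormulaSemantics {c ℓ : Level} (K : AbelianGroup c ℓ) where
  open AbelianGroup K
  open Multiples K
  open TermSemantics K
  open import Algebra.Solver.CommutativeMonoid commutativeMonoid using (solve; _⊜_; _⊕_)
  open import Algebra.Properties.Group group using (//-rightDividesˡ; //-rightDividesʳ)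
  open import Relation.Binary.Reasoning.Setoid setoid

  ⋀-elim : ∀ {k n} (f : Fin k → Φ n) {μ} → Val K (⋀ f) μ → ∀ i → Val K (f i) μ
  ⋀-elim f (v , _) zero = v
  ⋀-elim f (_ , vs) (suc i) = ⋀-elim (f ∘ suc) vs i

  ⋀-intro : ∀ {k n} (f : Fin k → Φ n) {μ} → (∀ i → Val K (f i) μ) → Val K (⋀ f) μ
  ⋀-intro {zero} f vs = lift refl
  ⋀-intro {suc _} f vs = vs zero , ⋀-intro (f ∘ suc) (vs ∘ suc)

  ⋁<-elim : ∀ {n} m (f : ℕ → Φ n) {μ} → Val K (⋁< m f) μ → Σ ℕ λ a → Val K (f a) μ
  ⋁<-elim zero f v = ⊥-elim (v (lift refl))
  ⋁<-elim (suc m) f (inj₁ v) = m , v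
  ⋁<-elim (suc m) f (inj₂ v) = ⋁<-elim m f v

  ⋁<-intro : ∀ {n} m (f : ℕ → Φ n) {μ} a → a < m → Val K (f a) μ → Val K (⋁< m f) μ
  ⋁<-intro (suc m) f a a<1+m v with ℕP.m<1+n⇒m<n∨m≡n a<1+m
  ... | inj₁ a<m = inj₂ (⋁<-intro m f a a<m v)
  ... | inj₂ ≡.refl = inj₁ v

  ∃₀-elim : ∀ {n} (u : Φ (suc n)) {μ} → Val K (∃₀ u) μ →
            Σ (Point K (suc n)) λ ν → (∀ i → ν (suc i) ≈ μ i) × Val K u ν
  ∃₀-elim u (ν , agree , v) = ν , (λ i → agree (suc i) (λ ())) , v

  ∃₀-intro : ∀ {n} (u : Φ (suc n)) {μ} (ν : Point K (suc n)) → (∀ i → ν (suc i) ≈ μ i) → Val K u ν →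
             Val K (∃₀ u) μ
  ∃₀-intro u ν agree v = ν , agree′ , v
    where
    agree′ : ∀ y → y ≡.≢ zero → ν y ≈ _
    agree′ zero y≢0 = contradiction ≡.refl y≢0
    agree′ (suc i) _ = agree i

  ∀₀-elim : ∀ {n} (u : Φ (suc n)) {μ} → Val K (∀₀ u) μ → ∀ x → ¬ ¬ Val K u (x ∷ μ)
  ∀₀-elim u {μ} all x ¬v = all (∃₀-intro (¬' u) (x ∷ μ) (λ _ → refl) ¬v)

  ∀₀-intro : ∀ {n} (u : Φ (suc n)) {μ} → (∀ ν → (∀ i → ν (suc i) ≈ μ i) → Val K u ν) → Val K (∀₀ u) μ
  ∀₀-intro u all ex with ∃₀-elim (¬' u) ex
  ... | ν , agree , ¬v = ¬v (all ν agree)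

  ∃ⁿ-elim : ∀ k {n} (u : Φ (k ℕ.+ n)) {μ} → Val K (∃ⁿ k u) μ →
            Σ (Point K (k ℕ.+ n)) λ ρ → (∀ i → ρ (k ↑ʳ i) ≈ μ i) × Val K u ρ
  ∃ⁿ-elim zero u v = _ , (λ _ → refl) , v
  ∃ⁿ-elim (suc k) u v with ∃ⁿ-elim k (∃₀ u) v
  ... | ρ₁ , agree₁ , v₁ with ∃₀-elim u v₁
  ...   | ρ , agree , v′ = ρ , (λ i → trans (agree (k ↑ʳ i)) (agree₁ i)) , v′

  ∃ⁿ-intro : ∀ k {n} (u : Φ (k ℕ.+ n)) {μ} (c : Point K k) → Val K u (c ++ μ) → Val K (∃ⁿ k u) μ
  ∃ⁿ-intro zero u c v = v
  ∃ⁿ-intro (suc k) u {μ} c v = ∃ⁿ-intro k (∃₀ u) (tail c) (∃₀-intro u (c ++ μ) shift v)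
    where
    shift : ∀ i → (c ++ μ) (suc i) ≈ (tail c ++ μ) i
    shift i = reflexive ([,]-map (splitAt k i))

  inImage-sound : ∀ {k n} (A : Fin n → Fin k → ℤ) {μ} → Val K (inImage A) μ →
                  Σ (Point K k) λ y → ∀ i → μ i ≈ lincomb K (A i) y
  inImage-sound {k} {n} A {μ} v with ∃ⁿ-elim k _ v
  ... | ρ , agree , eqs = (λ j → ρ (j ↑ˡ n)) , λ i → begin
    μ i                                            ≈⟨ agree i ⟨
    ρ (k ↑ʳ i)                                     ≈⟨ lower (⋀-elim _ eqs i) ⟩
    eval K ρ (linTerm (A i) (λ j → var (j ↑ˡ n)))  ≡⟨ eval-linTerm ρ (A i) _ ⟩
    lincomb K (A i) (λ j → ρ (j ↑ˡ n))             ∎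

  inImage-complete : ∀ {k n} (A : Fin n → Fin k → ℤ) {μ} (y : Point K k) →
                     (∀ i → μ i ≈ lincomb K (A i) y) → Val K (inImage A) μ
  inImage-complete {k} {n} A {μ} y μ≈Ay = ∃ⁿ-intro k _ y (⋀-intro _ λ i → lift (begin
    (y ++ μ) (k ↑ʳ i)                                    ≡⟨ lookup-++ʳ y μ i ⟩
    μ i                                                  ≈⟨ μ≈Ay i ⟩
    lincomb K (A i) y                                    ≈⟨ lincomb-cong (λ _ → ≡.refl) (λ j → reflexive (≡.sym (lookup-++ˡ y μ j))) ⟩
    lincomb K (A i) (λ j → (y ++ μ) (j ↑ˡ n))            ≡⟨ eval-linTerm (y ++ μ) (A i) _ ⟨
    eval K (y ++ μ) (linTerm (A i) (λ j → var (j ↑ˡ n))) ∎))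

  spanMod-sound : ∀ m n {μ : Point K (suc n)} → Val K (spanMod m n) μ →
                  Σ (Fin n → ℤ) λ k → Σ Carrier λ z → μ zero ≈ lincomb K k (tail μ) ∙ m ·ℕ z
  spanMod-sound m zero {μ} v with ∃₀-elim (var (suc zero) ≐ mulℕT m (var zero)) v
  ... | ν , agree , lift eq = (λ ()) , ν zero , (begin
    μ zero                            ≈⟨ agree zero ⟨
    ν (suc zero)                      ≈⟨ eq ⟩
    eval K ν (mulℕT m (var zero))     ≡⟨ eval-mulℕT ν m (var zero) ⟩
    m ·ℕ ν zero                       ≈⟨ identityˡ _ ⟨
    ε ∙ m ·ℕ ν zero                   ∎)
  spanMod-sound m (suc n) {μ} v with ⋁<-elim m _ v
  ... | a , va with spanMod-sound m n va
  ...   | k , z , eq = (+ a ∷ k) , z , (begin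
    μ zero                                          ≈⟨ //-rightDividesˡ (a ·ℕ μ₁) (μ zero) ⟨
    (μ zero ∙ (a ·ℕ μ₁) ⁻¹) ∙ a ·ℕ μ₁               ≡⟨ ≡.cong (λ w → (μ zero ∙ w ⁻¹) ∙ a ·ℕ μ₁) (eval-mulℕT μ a (var (suc zero))) ⟨
    (μ zero ∙ (eval K μ (mulℕT a (var (suc zero)))) ⁻¹) ∙ a ·ℕ μ₁
                                                    ≈⟨ ∙-congʳ eq ⟩
    (L ∙ m ·ℕ z) ∙ a ·ℕ μ₁                          ≈⟨ solve 3 (λ l w y → (l ⊕ w) ⊕ y ⊜ (y ⊕ l) ⊕ w) refl L (m ·ℕ z) _ ⟩
    (a ·ℕ μ₁ ∙ L) ∙ m ·ℕ z                          ∎)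
    where
    μ₁ = μ (suc zero)
    L = lincomb K k (tail (tail μ))

  spanMod-complete : ∀ m .{{_ : ℕ.NonZero m}} n {μ : Point K (suc n)} (k : Fin n → ℤ) z →
                     μ zero ≈ lincomb K k (tail μ) ∙ m ·ℕ z → Val K (spanMod m n) μ
  spanMod-complete m zero {μ} k z eq = ∃₀-intro (var (suc zero) ≐ mulℕT m (var zero)) (z ∷ μ) (λ _ → refl) (lift (begin
    μ zero                             ≈⟨ eq ⟩
    ε ∙ m ·ℕ z                         ≈⟨ identityˡ _ ⟩
    m ·ℕ z                             ≡⟨ eval-mulℕT (z ∷ μ) m (var zero) ⟨
    eval K (z ∷ μ) (mulℕT m (var zero)) ∎))
  spanMod-complete m (suc n) {μ} k z eq =
    ⋁<-intro m _ r (n%ℕd<d (k zero) m) (spanMod-complete m n (k ∘ suc) (z ∙ q · μ₁) (begin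
      μ zero ∙ (eval K μ (mulℕT r (var (suc zero)))) ⁻¹  ≡⟨ ≡.cong (λ w → μ zero ∙ w ⁻¹) (eval-mulℕT μ r (var (suc zero))) ⟩
      μ zero ∙ (r ·ℕ μ₁) ⁻¹                              ≈⟨ ∙-congʳ rearranged ⟨
      ((L ∙ m ·ℕ (z ∙ q · μ₁)) ∙ r ·ℕ μ₁) ∙ (r ·ℕ μ₁) ⁻¹  ≈⟨ //-rightDividesʳ (r ·ℕ μ₁) _ ⟩
      L ∙ m ·ℕ (z ∙ q · μ₁)                              ∎))
    where
    r = k zero %ℕ m
    q = k zero /ℕ m
    μ₁ = μ (suc zero)
    L = lincomb K (k ∘ suc) (tail (tail μ))
    rearranged : (L ∙ m ·ℕ (z ∙ q · μ₁)) ∙ r ·ℕ μ₁ ≈ μ zero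
    rearranged = begin
      (L ∙ m ·ℕ (z ∙ q · μ₁)) ∙ r ·ℕ μ₁            ≈⟨ ∙-congʳ (∙-congˡ (·ℕ-∙ m z (q · μ₁))) ⟩
      (L ∙ (m ·ℕ z ∙ m ·ℕ (q · μ₁))) ∙ r ·ℕ μ₁     ≈⟨ solve 4 (λ l w v y → (l ⊕ (w ⊕ v)) ⊕ y ⊜ ((y ⊕ v) ⊕ l) ⊕ w) refl L _ _ _ ⟩
      ((r ·ℕ μ₁ ∙ m ·ℕ (q · μ₁)) ∙ L) ∙ m ·ℕ z     ≈⟨ ∙-congʳ (∙-congʳ (·-divMod m (k zero) μ₁)) ⟨
      (k zero · μ₁ ∙ L) ∙ m ·ℕ z                   ≈⟨ eq ⟨
      μ zero                                       ∎

SameLKer-sym : ∀ {c ℓ c' ℓ'} (H : AbelianGroup c ℓ) (G : AbelianGroup c' ℓ') {n} {μ : Point H n} {ν : Point G n} →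
               SameLKer H G μ ν → SameLKer G H ν μ
SameLKer-sym H G same u = proj₂ (same u) , proj₁ (same u)

SameLKer-trans : ∀ {c ℓ c' ℓ' c'' ℓ''} (H : AbelianGroup c ℓ) (G : AbelianGroup c' ℓ') (K : AbelianGroup c'' ℓ'')
                 {n} {μ : Point H n} {ν : Point G n} {κ : Point K n} →
                 SameLKer H G μ ν → SameLKer G K ν κ → SameLKer H K μ κ
SameLKer-trans H G K same same' u = proj₁ (same' u) ∘ proj₁ (same u) , proj₂ (same u) ∘ proj₂ (same' u)

SameLKer-push : ∀ {c ℓ c' ℓ'} (H : AbelianGroup c ℓ) (G : AbelianGroup c' ℓ') {m n} (s : Fin m → Term n)
                {μ : Point H n} {ν : Point G n} →
                SameLKer H G μ ν → SameLKer H G (compose H μ s) (compose G ν s)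
SameLKer-push H G s same u = same (push s u)

Isotyped-sym : ∀ {c ℓ c' ℓ'} (H : AbelianGroup c ℓ) (G : AbelianGroup c' ℓ') → Isotyped H G → Isotyped G H
Isotyped-sym H G (H→G , G→H) =
  (λ n ν → proj₁ (G→H n ν) , SameLKer-sym H G (proj₂ (G→H n ν))) ,
  (λ n μ → proj₁ (H→G n μ) , SameLKer-sym H G (proj₂ (H→G n μ)))

multiple-of-larger⇒0 : ∀ a d → a ≡ + suc ∣ a ∣ ℤ.* d → a ≡ + 0
multiple-of-larger⇒0 a d a≡ =
  ℤP.∣i∣≡0⇒i≡0 (n≡0 ∣ a ∣ ∣ d ∣ (≡.trans (≡.cong ∣_∣ a≡) (ℤP.abs-* (+ suc ∣ a ∣) d)))
  where
  n≡0 : ∀ n q → n ≡ suc n ℕ.* q → n ≡ 0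
  n≡0 zero q _ = ≡.refl
  n≡0 (suc n) q eq = contradiction (≡.subst (suc (suc n) ∣_) (≡.sym eq) (m∣m*n q)) (>⇒∤ (ℕP.n<1+n (suc n)))

module Basis {c ℓ : Level} (H : AbelianGroup c ℓ) {n : ℕ} (b : Point H n)
  (spans : ∀ h → Σ (Fin n → ℤ) λ k → AbelianGroup._≈_ H (lincomb H k b) h)
  (independent : ∀ k k' → AbelianGroup._≈_ H (lincomb H k b) (lincomb H k' b) → ∀ i → k i ≡ k' i) where
  open AbelianGroup H
  open Multiples H
  open FormulaSemantics H
  open import Algebra.Properties.Group group using (inverseˡ-unique; x∙y⁻¹≈ε⇒x≈y)
  open import Relation.Binary.Reasoning.Setoid setoid

  coords : Carrier → Fin n → ℤ
  coords h = proj₁ (spans h)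

  coords-spec : ∀ h → lincomb H (coords h) b ≈ h
  coords-spec h = proj₂ (spans h)

  coords-unique : ∀ k {h} → lincomb H k b ≈ h → ∀ i → coords h i ≡ k i
  coords-unique k {h} eq = independent (coords h) k (trans (coords-spec h) (sym eq))

  coords-cong : ∀ {x y} → x ≈ y → ∀ i → coords x i ≡ coords y i
  coords-cong {x} x≈y i = ≡.sym (coords-unique (coords x) (trans (coords-spec x) x≈y) i)

  coords-lincomb : ∀ k i → coords (lincomb H k b) i ≡ k i
  coords-lincomb k = coords-unique k refl

  coords-∙ : ∀ x y i → coords (x ∙ y) i ≡ coords x i ℤ.+ coords y i
  coords-∙ x y = coords-unique _ (trans (lincomb-+ (coords x) (coords y) b) (∙-cong (coords-spec x) (coords-spec y)))

  coords-·ℕ : ∀ m w i → coords (m ·ℕ w) i ≡ + m ℤ.* coords w i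
  coords-·ℕ m w = coords-unique _ (trans (sym (lincomb-·ℕ m (coords w) b)) (·ℕ-congʳ m (coords-spec w)))

  module Extension {c' ℓ' : Level} (K : AbelianGroup c' ℓ') (t : Point K n) where
    private
      module K = AbelianGroup K
      module MK = Multiples K

    extend : Carrier → K.Carrier
    extend h = lincomb K (coords h) t

    extend-cong : ∀ {x y} → x ≈ y → extend x K.≈ extend y
    extend-cong x≈y = MK.lincomb-cong (coords-cong x≈y) (λ _ → K.refl)

    extend-∙ : ∀ x y → extend (x ∙ y) K.≈ extend x K.∙ extend y
    extend-∙ x y = K.trans (MK.lincomb-cong (coords-∙ x y) (λ _ → K.refl)) (MK.lincomb-+ _ _ t)

    extend-lincomb : ∀ k → extend (lincomb H k b) K.≈ lincomb K k t
    extend-lincomb k = MK.lincomb-cong (coords-lincomb k) (λ _ → K.refl)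

    open Homomorphism H K extend extend-cong extend-∙ public

  -- H has no nonzero element divisible by every positive integer: a coordinate c ≠ 0 of x
  -- would be a multiple of |c| + 1.
  divisible⇒ε : ∀ x → (∀ m → ¬ ¬ Σ Carrier λ w → x ≈ suc m ·ℕ w) → x ≈ ε
  divisible⇒ε x divisible = begin
    x                            ≈⟨ coords-spec x ⟨
    lincomb H (coords x) b       ≈⟨ lincomb-cong coords-zero (λ _ → refl) ⟩
    lincomb H (λ _ → + 0) b      ≈⟨ lincomb-0 b ⟩
    ε                            ∎
    where
    coords-zero : ∀ i → coords x i ≡ + 0
    coords-zero i with coords x i ℤ.≟ + 0
    ... | yes c≡0 = c≡0
    ... | no c≢0 = contradiction (λ (w , x≈mw) → c≢0 (multiple-of-larger⇒0 (coords x i) (coords w i)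
                     (≡.trans (coords-cong x≈mw i) (coords-·ℕ (suc ∣ coords x i ∣) w i))))
                   (divisible ∣ coords x i ∣)

  module SameTypeAsBasis (μ : Point H n) (same : SameLKer H H b μ) where
    A : Fin n → Fin n → ℤ
    A i = coords (μ i)

    -- μ = A b lies in the image of A, hence so does b
    b-in-image : Σ (Point H n) λ y → ∀ i → b i ≈ lincomb H (A i) y
    b-in-image = inImage-sound A (proj₂ (same (inImage A)) (inImage-complete A b (λ i → sym (coords-spec (μ i)))))

    module ψ-hom = Extension H (proj₁ b-in-image)
    module φ-hom = Extension H μ

    -- ψ : bᵢ ↦ yᵢ where b = A y, so ψ(μᵢ) = bᵢ;  φ : bᵢ ↦ μᵢ
    ψ φ : Carrier → Carrier
    ψ = ψ-hom.extend
    φ = φ-hom.extend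

    ψ-lincomb-μ : ∀ k → ψ (lincomb H k μ) ≈ lincomb H k b
    ψ-lincomb-μ k = trans (ψ-hom.F-lincomb k μ) (lincomb-cong (λ _ → ≡.refl) ψ-μ)
      where
      ψ-μ : ∀ i → ψ (μ i) ≈ b i
      ψ-μ i = begin
        ψ (μ i)                          ≈⟨ ψ-hom.extend-cong (coords-spec (μ i)) ⟨
        ψ (lincomb H (A i) b)            ≈⟨ ψ-hom.extend-lincomb (A i) ⟩
        lincomb H (A i) (proj₁ b-in-image) ≈⟨ proj₂ b-in-image i ⟨
        b i                              ∎

    ψ∘φ : ∀ h → ψ (φ h) ≈ h
    ψ∘φ h = trans (ψ-lincomb-μ (coords h)) (coords-spec h)

    -- H = ⟨μ⟩ + (m+1)·H, up to double negation, because the same sentence holds for b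
    generates-mod : ∀ m x → ¬ ¬ Σ (Fin n → ℤ) λ k → Σ Carrier λ z → x ≈ lincomb H k μ ∙ suc m ·ℕ z
    generates-mod m x =
      ¬¬-map (spanMod-sound (suc m) n) (∀₀-elim (spanMod (suc m) n) (proj₁ (same (∀₀ (spanMod (suc m) n))) at-b) x)
      where
      at-b : Val H (∀₀ (spanMod (suc m) n)) b
      at-b = ∀₀-intro (spanMod (suc m) n) λ ν tail-ν≈b → spanMod-complete (suc m) n (coords (ν zero)) ε (begin
        ν zero                                      ≈⟨ coords-spec (ν zero) ⟨
        lincomb H (coords (ν zero)) b               ≈⟨ lincomb-cong (λ _ → ≡.refl) (sym ∘ tail-ν≈b) ⟩
        lincomb H (coords (ν zero)) (tail ν)        ≈⟨ identityʳ _ ⟨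
        lincomb H (coords (ν zero)) (tail ν) ∙ ε    ≈⟨ ∙-congˡ (·ℕ-ε (suc m)) ⟨
        lincomb H (coords (ν zero)) (tail ν) ∙ suc m ·ℕ ε ∎)

    -- if x = Σ kᵢμᵢ + m·z lies in ker ψ, then Σ kᵢbᵢ = −m·ψ z, so Σ kᵢμᵢ = −m·φ(ψ z)
    -- and x = m·(z − φ(ψ z))
    kernel-divisible : ∀ m x → ψ x ≈ ε → (Σ (Fin n → ℤ) λ k → Σ Carrier λ z → x ≈ lincomb H k μ ∙ m ·ℕ z) →
                       Σ Carrier λ w → x ≈ m ·ℕ w
    kernel-divisible m x ψx≈ε (k , z , x≈) = z ∙ φ (ψ z) ⁻¹ , (begin
      x                                    ≈⟨ x≈ ⟩
      lincomb H k μ ∙ m ·ℕ z               ≈⟨ ∙-congʳ combination ⟩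
      (m ·ℕ φ (ψ z)) ⁻¹ ∙ m ·ℕ z           ≈⟨ comm _ _ ⟩
      m ·ℕ z ∙ (m ·ℕ φ (ψ z)) ⁻¹           ≈⟨ ∙-congˡ (·ℕ-⁻¹ m _) ⟨
      m ·ℕ z ∙ m ·ℕ (φ (ψ z) ⁻¹)           ≈⟨ ·ℕ-∙ m _ _ ⟨
      m ·ℕ (z ∙ φ (ψ z) ⁻¹)                ∎)
      where
      image-vanishes : lincomb H k b ∙ m ·ℕ ψ z ≈ ε
      image-vanishes = begin
        lincomb H k b ∙ m ·ℕ ψ z           ≈⟨ ∙-cong (ψ-lincomb-μ k) (ψ-hom.F-·ℕ m z) ⟨
        ψ (lincomb H k μ) ∙ ψ (m ·ℕ z)     ≈⟨ ψ-hom.extend-∙ _ _ ⟨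
        ψ (lincomb H k μ ∙ m ·ℕ z)         ≈⟨ ψ-hom.extend-cong x≈ ⟨
        ψ x                                ≈⟨ ψx≈ε ⟩
        ε                                  ∎
      combination : lincomb H k μ ≈ (m ·ℕ φ (ψ z)) ⁻¹
      combination = begin
        lincomb H k μ                      ≈⟨ φ-hom.extend-lincomb k ⟨
        φ (lincomb H k b)                  ≈⟨ φ-hom.extend-cong (inverseˡ-unique _ _ image-vanishes) ⟩
        φ ((m ·ℕ ψ z) ⁻¹)                  ≈⟨ φ-hom.F-⁻¹ _ ⟩
        φ (m ·ℕ ψ z) ⁻¹                    ≈⟨ ⁻¹-cong (φ-hom.F-·ℕ m _) ⟩
        (m ·ℕ φ (ψ z)) ⁻¹                  ∎

    kernel-trivial : ∀ x → ψ x ≈ ε → x ≈ ε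
    kernel-trivial x ψx≈ε = divisible⇒ε x λ m → ¬¬-map (kernel-divisible (suc m) x ψx≈ε) (generates-mod m x)

    -- h − φ(ψ h) lies in ker ψ because ψ ∘ φ = id, so h = φ(ψ h) = Σ coords(ψ h)ᵢ μᵢ
    generates : ∀ h → Σ (Fin n → ℤ) λ k → lincomb H k μ ≈ h
    generates h = coords (ψ h) , sym (x∙y⁻¹≈ε⇒x≈y h (φ (ψ h)) (kernel-trivial _ ψ-vanishes))
      where
      ψ-vanishes : ψ (h ∙ φ (ψ h) ⁻¹) ≈ ε
      ψ-vanishes = begin
        ψ (h ∙ φ (ψ h) ⁻¹)                 ≈⟨ ψ-hom.extend-∙ _ _ ⟩
        ψ h ∙ ψ (φ (ψ h) ⁻¹)               ≈⟨ ∙-congˡ (ψ-hom.F-⁻¹ _) ⟩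
        ψ h ∙ ψ (φ (ψ h)) ⁻¹               ≈⟨ ∙-congˡ (⁻¹-cong (ψ∘φ _)) ⟩
        ψ h ∙ ψ h ⁻¹                       ≈⟨ inverseʳ _ ⟩
        ε                                  ∎

module FreeIsotyped {c ℓ c' ℓ' : Level} (H : AbelianGroup c ℓ) (G : AbelianGroup c' ℓ') (isotyped : Isotyped H G)
  {n : ℕ} (b : Point H n)
  (spans : ∀ h → Σ (Fin n → ℤ) λ k → AbelianGroup._≈_ H (lincomb H k b) h)
  (independent : ∀ k k' → AbelianGroup._≈_ H (lincomb H k b) (lincomb H k' b) → ∀ i → k i ≡ k' i) where
  open Basis H b spans independent
  private
    module H = AbelianGroup H
    module G = AbelianGroup G
    module HT = TermSemantics H
    module GT = TermSemantics G

  ν : Point G n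
  ν = proj₁ (proj₁ isotyped n b)

  b~ν : SameLKer H G b ν
  b~ν = proj₂ (proj₁ isotyped n b)

  open Extension G ν using () renaming (extend to f; extend-cong to f-cong; extend-∙ to f-∙; extend-lincomb to f-lincomb)

  -- f x = f y is the equation Σ coords(x)ᵢ xᵢ ≐ Σ coords(y)ᵢ xᵢ at ν, which transfers to b
  f-injective : ∀ {x y} → f x G.≈ f y → x H.≈ y
  f-injective {x} {y} fx≈fy = H.trans (H.sym (coords-spec x)) (H.trans (at-b (proj₂ (b~ν equation) at-ν)) (coords-spec y))
    where
    equation : Φ n
    equation = linTerm (coords x) var ≐ linTerm (coords y) var
    at-ν : Val G equation ν
    at-ν = lift (G.trans (G.reflexive (GT.eval-linTerm ν (coords x) var))
                 (G.trans fx≈fy (G.reflexive (≡.sym (GT.eval-linTerm ν (coords y) var)))))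
    at-b : Val H equation b → lincomb H (coords x) b H.≈ lincomb H (coords y) b
    at-b (lift eq) = H.trans (H.reflexive (≡.sym (HT.eval-linTerm b (coords x) var)))
                     (H.trans eq (H.reflexive (HT.eval-linTerm b (coords y) var)))

  -- for g ∈ G take ρ of the type of (g, ν); its tail has the type of b, so it generates H and
  -- ρ₀ = Σ kᵢρᵢ₊₁; the formula x₀ ≐ Σ kᵢxᵢ₊₁ then gives g = Σ kᵢνᵢ = f(Σ kᵢbᵢ)
  f-surjective : ∀ g → Σ H.Carrier λ x → f x G.≈ g
  f-surjective g = lincomb H k b , G.trans (f-lincomb k) (G.sym g≈kν)
    where
    ρ : Point H (suc n)
    ρ = proj₁ (proj₂ isotyped (suc n) (g ∷ ν))
    ρ~gν : SameLKer H G ρ (g ∷ ν)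
    ρ~gν = proj₂ (proj₂ isotyped (suc n) (g ∷ ν))
    b~tail-ρ : SameLKer H H b (tail ρ)
    b~tail-ρ = SameLKer-trans H G H b~ν (SameLKer-sym H G (SameLKer-push H G (var ∘ suc) ρ~gν))
    open Basis.SameTypeAsBasis H b spans independent (tail ρ) b~tail-ρ using (generates)
    k : Fin n → ℤ
    k = proj₁ (generates (ρ zero))
    equation : Φ (suc n)
    equation = var zero ≐ linTerm k (var ∘ suc)
    at-ρ : Val H equation ρ
    at-ρ = lift (H.trans (H.sym (proj₂ (generates (ρ zero)))) (H.reflexive (≡.sym (HT.eval-linTerm ρ k (var ∘ suc)))))
    g≈kν : g G.≈ lincomb G k ν
    g≈kν = G.trans (lower (proj₁ (ρ~gν equation) at-ρ)) (G.reflexive (GT.eval-linTerm (g ∷ ν) k (var ∘ suc)))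

  isomorphism : Isomorphic H G
  isomorphism = bijective-homomorphism⇒isomorphic H G f f-cong f-∙ f-injective f-surjective

theorem5p3 : ∀ {c ℓ c' ℓ' : Level} (H : AbelianGroup c ℓ) (G : AbelianGroup c' ℓ') →
    Isotyped H G → (IsFinGenFree H ⊎ IsFinGenFree G) → Isomorphic H G
theorem5p3 H G isotyped (inj₁ (_ , b , spans , independent)) =
  FreeIsotyped.isomorphism H G isotyped b spans independent
theorem5p3 H G isotyped (inj₂ (_ , b , spans , independent)) =
  isomorphic-sym H G (FreeIsotyped.isomorphism G H (Isotyped-sym H G isotyped) b spans independent)
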